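{- The subword patterns $1232$ and $1322$ are in the same strong Wilf class: for all $k\ge1$, $n\ge0$, $r\ge0$, the number of words in $[k]^n$ containing $1232$ exactly $r$ times equals the number containing $1322$ exactly $r$ times.
   Context: $[k]^n$ is the set of words of length $n$ over $\{1,\dots,k\}$. An occurrence of a subword pattern $\tau$ of length $l$ in $\sigma=\sigma_1\cdots\sigma_n$ is an index $i$ such that the consecutive factor $\sigma_i\cdots\sigma_{i+l-1}$ is order-isomorphic to $\tau$ (same relative order and same equalities among positions); "containing exactly $r$ times" means having exactly $r$ occurrences. -}

module Defs where

open import Data.Nat using (ℕ; zero; suc; _+_; _∸_; _<ᵇ_; _≡ᵇ_; _≟_)
open import Data.Bool using (Bool; true; false; _∧_; if_then_else_)
open import Data.Fin using (Fin; toℕ)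
open import Data.Vec using (Vec; []; _∷_; toList)
open import Data.List using (List; []; _∷_; length; map; concatMap; drop; take; upTo; lookup; filter; allFin)
open import Relation.Nullary.Decidable using (does)
open import Data.Bool.Properties using (T?)
open import Relation.Binary.PropositionalEquality using (_≡_)
import Data.Nat as ℕ
import Relation.Binary.PropositionalEquality

-- Words of length n over [k] = {1,…,k}, represented as Vec (Fin k) n
-- (letter j ∈ [k] is represented by the Fin k element j-1; shifting does not
-- change order-isomorphism).
Word : ℕ → ℕ → Set
Word k n = Vec (Fin k) n

allWords : (k n : ℕ) → List (Word k n)
allWords k zero    = [] ∷ []
allWords k (suc n) = concatMap (λ a → map (a ∷_) (allWords k n)) (allFin k)

_==_ : Bool → Bool → Bool
true  == b = b
false == true  = false
false == false = true

all : ∀ {A : Set} → (A → Bool) → List A → Bool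
all p []       = true
all p (x ∷ xs) = p x ∧ all p xs

at : List ℕ → ℕ → ℕ
at []       _       = 0
at (x ∷ xs) zero    = x
at (x ∷ xs) (suc i) = at xs i

orderIso : List ℕ → List ℕ → Bool
orderIso u v =
  (length u ≡ᵇ length v) ∧
  all (λ a → all (λ b →
         ((at u a <ᵇ at u b) == (at v a <ᵇ at v b)) ∧
         ((at u a ≡ᵇ at u b) == (at v a ≡ᵇ at v b)))
       (upTo (length u)))
      (upTo (length u))

occurrences : List ℕ → List ℕ → ℕ
occurrences τ σ =
  length (filter (λ i → T? (orderIso (take (length τ) (drop i σ)) τ))
                 (upTo (suc (length σ ∸ length τ))))

occ : ∀ {k n} → List ℕ → Word k n → ℕ
occ τ σ = occurrences τ (map toℕ (toList σ))

countWords : List ℕ → (k n r : ℕ) → ℕ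
countWords τ k n r = length (filter (λ σ → occ τ σ ≟ r) (allWords k n))

private
  test1 : occurrences (1 ∷ 2 ∷ 3 ∷ 2 ∷ []) (1 ∷ 4 ∷ 7 ∷ 4 ∷ 9 ∷ 11 ∷ 9 ∷ []) ≡ 2
  test1 = Relation.Binary.PropositionalEquality.refl
  test2 : length (allWords 3 4) ≡ 81
  test2 = Relation.Binary.PropositionalEquality.refl
  test3 : occurrences (1 ∷ 2 ∷ []) (1 ∷ []) ≡ 0
  test3 = Relation.Binary.PropositionalEquality.refl
  test4 : occurrences (1 ∷ 2 ∷ 3 ∷ 2 ∷ []) (1 ∷ 4 ∷ 7 ∷ 5 ∷ []) ≡ 0
  test4 = Relation.Binary.PropositionalEquality.refl
  test5 : countWords (1 ∷ 2 ∷ 3 ∷ 2 ∷ []) 3 5 1 ≡ countWords (1 ∷ 3 ∷ 2 ∷ 2 ∷ []) 3 5 1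
  test5 = Relation.Binary.PropositionalEquality.refl
  test6 : countWords (1 ∷ 2 ∷ 3 ∷ 2 ∷ []) 3 4 1 ≡ 1
  test6 = Relation.Binary.PropositionalEquality.refl

module Submission where

open import Defs
open import Data.Nat using (ℕ; zero; suc; _≥_; _<_; _≤_; _<ᵇ_; _≡ᵇ_; _≟_)
open import Data.Nat.Properties
  using (<ᵇ⇒<; <⇒<ᵇ; ≡ᵇ⇒≡; ≡⇒≡ᵇ; ≤-refl; <⇒≤; <⇒≢; <⇒≱; <-trans)
open import Data.Bool using (Bool; true; false; _∧_; _∨_; T; if_then_else_)
open import Data.Bool.Properties using (T-≡; T-∧; T-∨; ¬-not; ∨-comm; ∨-conicalˡ; ∨-conicalʳ)
open import Data.Unit using (⊤; tt)
open import Data.Empty using (⊥; ⊥-elim)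
open import Data.Sum using (inj₁; inj₂)
open import Data.Product using (_×_; _,_; proj₁; proj₂)
open import Data.Fin using (Fin; toℕ; #_)
open import Data.Fin.Properties using (toℕ<n)
open import Data.Vec using (Vec; []; _∷_; toList)
open import Data.Vec.Properties using (∷-injective)
open import Data.List
  using ( List; []; _∷_; length; map; filter; take; drop; upTo; allFin; concatMap
        ; cartesianProductWith; _++_)
open import Data.List.Properties using (map-upTo; filter-≐)
open import Data.List.Membership.Propositional using (_∈_)
open import Data.List.Membership.Propositional.Properties
  using (∈-map⁺; ∈-allFin; ∈-upTo⁺; ∈-cartesianProductWith⁺)
open import Data.List.Membership.Propositional.Properties.WithK using (unique∧set⇒bag)
open import Data.List.Relation.Unary.Any using (here; there)
open import Data.List.Relation.Unary.Unique.Propositional using (Unique)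
open import Data.List.Relation.Unary.Unique.Propositional.Properties
  using (map⁺; allFin⁺; cartesianProductWith⁺)
open import Data.List.Relation.Unary.All using ([])
open import Data.List.Relation.Unary.AllPairs using ([]; _∷_)
open import Data.List.Relation.Binary.BagAndSetEquality using (∼bag⇒↭)
open import Data.List.Relation.Binary.Permutation.Propositional using (_↭_)
open import Data.List.Relation.Binary.Permutation.Propositional.Properties using (↭-length; filter-↭)
open import Function using (_∘_; id; Equivalence; _⇔_; mk⇔)
open import Level using (0ℓ)
open import Relation.Nullary using (does)
open import Relation.Nullary.Decidable using (T?)
open import Relation.Unary using (Pred; Decidable)
open import Relation.Binary.PropositionalEquality
  using (_≡_; _≢_; refl; sym; trans; cong; cong₂; subst; ≢-sym; module ≡-Reasoning)

-- A window a b c d is an occurrence of 1232 or of 1322 iff a < b, a < c, b ≠ c and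
-- d = min b c, the two patterns differing only by the order of b and c.  Two such
-- windows therefore start at least three positions apart, and exchanging the middle
-- letters of one of them neither creates nor destroys another.  So exchanging the
-- middle letters of all of them is an involution of [k]^n which turns every
-- 1232-occurrence into a 1322-occurrence and vice versa.

-- Involutions of an enumeration

length-filter-map : ∀ {A B : Set} {P : Pred B 0ℓ} (P? : Decidable P) (f : A → B) xs →
                    length (filter P? (map f xs)) ≡ length (filter (P? ∘ f) xs)
length-filter-map P? f [] = refl
length-filter-map P? f (x ∷ xs) with does (P? (f x))
... | true  = cong suc (length-filter-map P? f xs)
... | false = length-filter-map P? f xs

module _ {A : Set} {xs : List A} (unique : Unique xs) (complete : ∀ x → x ∈ xs)
         (φ : A → A) (involutive : ∀ x → φ (φ x) ≡ x) where

  map-involution-↭ : map φ xs ↭ xs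
  map-involution-↭ = ∼bag⇒↭ (unique∧set⇒bag (map⁺ injective unique) unique
    (λ {x} → mk⇔ (λ _ → complete x)
                 (λ _ → subst (_∈ map φ xs) (involutive x) (∈-map⁺ φ (complete (φ x))))))
    where
    injective : ∀ {x y} → φ x ≡ φ y → x ≡ y
    injective {x} {y} eq = trans (sym (involutive x)) (trans (cong φ eq) (involutive y))

  filter-≟-involution : ∀ (f g : A → ℕ) → (∀ x → f (φ x) ≡ g x) → ∀ r →
    length (filter (λ x → g x ≟ r) xs) ≡ length (filter (λ x → f x ≟ r) xs)
  filter-≟-involution f g fφ≡g r = begin
    length (filter (λ x → g x ≟ r) xs)
      ≡⟨ cong length (filter-≐ (λ x → g x ≟ r) (λ x → f (φ x) ≟ r)
                        ((λ {x} → trans (fφ≡g x)) , (λ {x} → trans (sym (fφ≡g x)))) xs) ⟩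
    length (filter (λ x → f (φ x) ≟ r) xs)
      ≡⟨ sym (length-filter-map (λ x → f x ≟ r) φ xs) ⟩
    length (filter (λ x → f x ≟ r) (map φ xs))
      ≡⟨ ↭-length (filter-↭ (λ x → f x ≟ r) map-involution-↭) ⟩
    length (filter (λ x → f x ≟ r) xs) ∎
    where open ≡-Reasoning

concatMap≡cartesianProductWith : ∀ {A B C : Set} (f : A → B → C) xs ys →
  concatMap (λ x → map (f x) ys) xs ≡ cartesianProductWith f xs ys
concatMap≡cartesianProductWith f []       ys = refl
concatMap≡cartesianProductWith f (x ∷ xs) ys =
  cong (map (f x) ys ++_) (concatMap≡cartesianProductWith f xs ys)

∈-allWords : ∀ k n (σ : Word k n) → σ ∈ allWords k n
∈-allWords k zero    []      = here refl
∈-allWords k (suc n) (a ∷ σ) =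
  subst (a ∷ σ ∈_) (sym (concatMap≡cartesianProductWith _∷_ (allFin k) (allWords k n)))
    (∈-cartesianProductWith⁺ _∷_ (∈-allFin a) (∈-allWords k n σ))

allWords-unique : ∀ k n → Unique (allWords k n)
allWords-unique k zero    = [] ∷ []
allWords-unique k (suc n) =
  subst Unique (sym (concatMap≡cartesianProductWith _∷_ (allFin k) (allWords k n)))
    (cartesianProductWith⁺ _∷_ ∷-injective (allFin⁺ k) (allWords-unique k n))

-- Exchanging the middle letters of windows of length four

countWindows : ∀ {A : Set} {n} → (A → A → A → A → Bool) → Vec A n → ℕ
countWindows Q (a ∷ b ∷ c ∷ d ∷ w) =
  (if Q a b c d then suc else id) (countWindows Q (b ∷ c ∷ d ∷ w))
countWindows Q _                   = 0

countWindows-cong : ∀ {A : Set} {n} {Q Q′ : A → A → A → A → Bool} →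
  (∀ a b c d → Q a b c d ≡ Q′ a b c d) → (σ : Vec A n) → countWindows Q σ ≡ countWindows Q′ σ
countWindows-cong Q≗Q′ (a ∷ σ@(b ∷ c ∷ d ∷ _)) =
  cong₂ (λ x → if x then suc else id) (Q≗Q′ a b c d) (countWindows-cong Q≗Q′ σ)
countWindows-cong Q≗Q′ []              = refl
countWindows-cong Q≗Q′ (_ ∷ [])        = refl
countWindows-cong Q≗Q′ (_ ∷ _ ∷ [])    = refl
countWindows-cong Q≗Q′ (_ ∷ _ ∷ _ ∷ []) = refl

module WindowSwap {A : Set} (R : A → A → A → A → Bool) where

  flipped : A → A → A → A → Bool
  flipped a b c d = R a c b d

  swappable : A → A → A → A → Bool
  swappable a b c d = R a b c d ∨ flipped a b c d

  swappable-flip : ∀ a b c d → swappable a c b d ≡ swappable a b c d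
  swappable-flip a b c d = ∨-comm (R a c b d) (R a b c d)

  swapAfter : ∀ {n} → A → Vec A n → Vec A n
  swapAfter a (b ∷ c ∷ d ∷ w) =
    if swappable a b c d then c ∷ b ∷ d ∷ swapAfter d w else b ∷ swapAfter b (c ∷ d ∷ w)
  swapAfter a w = w

  swapWindows : ∀ {n} → Vec A n → Vec A n
  swapWindows []      = []
  swapWindows (a ∷ w) = a ∷ swapAfter a w

  NoWindow : ∀ {n} → A → A → Vec A n → Set
  NoWindow a b (x ∷ y ∷ _) = swappable a b x y ≡ false
  NoWindow a b _           = ⊤

  swapAfter-skip : ∀ {n} a b (w : Vec A n) → NoWindow a b w → swapAfter a (b ∷ w) ≡ b ∷ swapAfter b w
  swapAfter-skip a b []          _  = refl
  swapAfter-skip a b (x ∷ [])    _  = refl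
  swapAfter-skip a b (x ∷ y ∷ w) eq rewrite eq = refl

  countWindows-skip : ∀ {n} (Q : A → A → A → A → Bool) →
    (∀ {a b c d} → swappable a b c d ≡ false → Q a b c d ≡ false) →
    ∀ a b (w : Vec A n) → NoWindow a b w → countWindows Q (a ∷ b ∷ w) ≡ countWindows Q (b ∷ w)
  countWindows-skip Q Q⊆S a b []          _  = refl
  countWindows-skip Q Q⊆S a b (x ∷ [])    _  = refl
  countWindows-skip Q Q⊆S a b (x ∷ y ∷ w) eq rewrite Q⊆S eq = refl

  module _ (sep₁ : ∀ a b c d e → swappable a b c d ≡ true → swappable b c d e ≡ true → ⊥)
           (sep₂ : ∀ a b c d e f → swappable a b c d ≡ true → swappable c d e f ≡ true → ⊥) where

    NoWindow-after : ∀ {n} a b c d (w : Vec A n) → swappable a b c d ≡ true → NoWindow b c (d ∷ w)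
    NoWindow-after a b c d []      _ = tt
    NoWindow-after a b c d (e ∷ w) s = ¬-not (sep₁ a b c d e s)

    NoWindow-after₂ : ∀ {n} a b c d (w : Vec A n) → swappable a b c d ≡ true → NoWindow c d w
    NoWindow-after₂ a b c d []          _ = tt
    NoWindow-after₂ a b c d (e ∷ [])    _ = tt
    NoWindow-after₂ a b c d (e ∷ f ∷ w) s = ¬-not (sep₂ a b c d e f s)

    NoWindow-swapAfter-tail : ∀ {n} a b c (w : Vec A n) →
      NoWindow a b (c ∷ w) → NoWindow a b (c ∷ swapAfter c w)
    NoWindow-swapAfter-tail a b c (d ∷ e ∷ f ∷ w) h with swappable c d e f in eq
    ... | true  = ¬-not (λ s → sep₂ a b c e d f s (trans (swappable-flip c d e f) eq))
    ... | false = h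
    NoWindow-swapAfter-tail a b c []          h = h
    NoWindow-swapAfter-tail a b c (d ∷ [])    h = h
    NoWindow-swapAfter-tail a b c (d ∷ e ∷ []) h = h

    NoWindow-swapAfter : ∀ {n} a b (w : Vec A n) → NoWindow a b w → NoWindow a b (swapAfter b w)
    NoWindow-swapAfter a b (c ∷ d ∷ e ∷ w) h with swappable b c d e in eq
    ... | true  = ¬-not (λ s → sep₁ a b d c e s (trans (swappable-flip b c d e) eq))
    ... | false = NoWindow-swapAfter-tail a b c (d ∷ e ∷ w) h
    NoWindow-swapAfter a b []          h = h
    NoWindow-swapAfter a b (c ∷ [])    h = h
    NoWindow-swapAfter a b (c ∷ d ∷ []) h = h

    swapAfter-involutive : ∀ {n} a (w : Vec A n) → swapAfter a (swapAfter a w) ≡ w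
    swapAfter-involutive a (b ∷ w@(c ∷ d ∷ w′))
      with swapAfter-involutive b w | swappable a b c d in eq
    ... | _  | true rewrite swappable-flip a b c d | eq =
      cong (λ v → b ∷ c ∷ d ∷ v) (swapAfter-involutive d w′)
    ... | ih | false = begin
      swapAfter a (b ∷ swapAfter b w)   ≡⟨ swapAfter-skip a b _ (NoWindow-swapAfter a b w eq) ⟩
      b ∷ swapAfter b (swapAfter b w)   ≡⟨ cong (b ∷_) ih ⟩
      b ∷ w                             ∎
      where open ≡-Reasoning
    swapAfter-involutive a []          = refl
    swapAfter-involutive a (b ∷ [])    = refl
    swapAfter-involutive a (b ∷ c ∷ []) = refl

    swapWindows-involutive : ∀ {n} (σ : Vec A n) → swapWindows (swapWindows σ) ≡ σ
    swapWindows-involutive []      = refl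
    swapWindows-involutive (a ∷ w) = cong (a ∷_) (swapAfter-involutive a w)

    countWindows-after : ∀ {n} (Q : A → A → A → A → Bool) →
      (∀ {a b c d} → swappable a b c d ≡ false → Q a b c d ≡ false) →
      ∀ a b c d (w : Vec A n) → swappable a b c d ≡ true →
      countWindows Q (b ∷ c ∷ d ∷ w) ≡ countWindows Q (d ∷ w)
    countWindows-after Q Q⊆S a b c d w s =
      trans (countWindows-skip Q Q⊆S b c (d ∷ w) (NoWindow-after a b c d w s))
            (countWindows-skip Q Q⊆S c d w (NoWindow-after₂ a b c d w s))

    countWindows-swapAfter : ∀ {n} a (w : Vec A n) →
      countWindows flipped (a ∷ swapAfter a w) ≡ countWindows R (a ∷ w)
    countWindows-swapAfter a (b ∷ w@(c ∷ d ∷ w′))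
      with countWindows-swapAfter b w | swappable a b c d in eq
    ... | _ | true = cong (if R a b c d then suc else id) (begin
      countWindows flipped (c ∷ b ∷ d ∷ swapAfter d w′)
        ≡⟨ countWindows-after flipped (∨-conicalʳ _ _) a c b d (swapAfter d w′)
             (trans (swappable-flip a b c d) eq) ⟩
      countWindows flipped (d ∷ swapAfter d w′)
        ≡⟨ countWindows-swapAfter d w′ ⟩
      countWindows R (d ∷ w′)
        ≡⟨ countWindows-after R (∨-conicalˡ _ _) a b c d w′ eq ⟨
      countWindows R (b ∷ w) ∎)
      where open ≡-Reasoning
    ... | ih | false = begin
      countWindows flipped (a ∷ b ∷ swapAfter b w)
        ≡⟨ countWindows-skip flipped (∨-conicalʳ _ _) a b _ (NoWindow-swapAfter a b w eq) ⟩
      countWindows flipped (b ∷ swapAfter b w)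
        ≡⟨ ih ⟩
      countWindows R (b ∷ w)
        ≡⟨ countWindows-skip R (∨-conicalˡ _ _) a b w eq ⟨
      countWindows R (a ∷ b ∷ w) ∎
      where open ≡-Reasoning
    countWindows-swapAfter a []          = refl
    countWindows-swapAfter a (b ∷ [])    = refl
    countWindows-swapAfter a (b ∷ c ∷ []) = refl

    countWindows-swapWindows : ∀ {n} (σ : Vec A n) →
      countWindows flipped (swapWindows σ) ≡ countWindows R σ
    countWindows-swapWindows []      = refl
    countWindows-swapWindows (a ∷ w) = countWindows-swapAfter a w

-- Occurrences as window counts

length-filter-upTo-suc : ∀ (p : ℕ → Bool) m →
  length (filter (T? ∘ p) (upTo (suc m))) ≡
  (if p 0 then suc else id) (length (filter (T? ∘ p ∘ suc) (upTo m)))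
length-filter-upTo-suc p m
  rewrite sym (length-filter-map (T? ∘ p) suc (upTo m)) | map-upTo suc m with p 0
... | true  = refl
... | false = refl

matches : ∀ {k} → List ℕ → Fin k → Fin k → Fin k → Fin k → Bool
matches τ a b c d = orderIso (toℕ a ∷ toℕ b ∷ toℕ c ∷ toℕ d ∷ []) τ

module _ (t₁ t₂ t₃ t₄ : ℕ) where

  private
    τ : List ℕ
    τ = t₁ ∷ t₂ ∷ t₃ ∷ t₄ ∷ []

    matchAt : ∀ {k n} → Word k n → ℕ → Bool
    matchAt σ i = orderIso (take 4 (drop i (map toℕ (toList σ)))) τ

  occ-countWindows : ∀ {k n} (σ : Word k n) → occ τ σ ≡ countWindows (matches τ) σ
  occ-countWindows []                             = refl
  occ-countWindows (a ∷ [])                       = refl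
  occ-countWindows (a ∷ b ∷ [])                   = refl
  occ-countWindows (a ∷ b ∷ c ∷ [])               = refl
  occ-countWindows σ@(a ∷ b ∷ c ∷ d ∷ [])         = length-filter-upTo-suc (matchAt σ) 0
  occ-countWindows σ@(a ∷ σ′@(b ∷ c ∷ d ∷ e ∷ w)) =
    trans (length-filter-upTo-suc (matchAt σ) _)
          (cong (if matches τ a b c d then suc else id) (occ-countWindows σ′))

T-== : ∀ {x y} → T (x == y) → T y → T x
T-== {true}          _  _  = tt
T-== {false} {false} _  ()

T-all : ∀ {A : Set} {p : A → Bool} {xs x} → T (all p xs) → x ∈ xs → T (p x)
T-all {p = p} {y ∷ _} h (here refl) = proj₁ (Equivalence.to (T-∧ {p y}) h)
T-all {p = p} {y ∷ _} h (there x∈) = T-all (proj₂ (Equivalence.to (T-∧ {p y}) h)) x∈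

module _ (u v : List ℕ) (u≅v : T (orderIso u v)) (i j : Fin (length u)) where

  private
    agree : T (((at u (toℕ i) <ᵇ at u (toℕ j)) == (at v (toℕ i) <ᵇ at v (toℕ j))) ∧
               ((at u (toℕ i) ≡ᵇ at u (toℕ j)) == (at v (toℕ i) ≡ᵇ at v (toℕ j))))
    agree = T-all (T-all (proj₂ (Equivalence.to (T-∧ {length u ≡ᵇ length v}) u≅v))
                         (∈-upTo⁺ (toℕ<n i)))
                  (∈-upTo⁺ (toℕ<n j))

  orderIso-<ᵇ : T (at v (toℕ i) <ᵇ at v (toℕ j)) → T (at u (toℕ i) <ᵇ at u (toℕ j))
  orderIso-<ᵇ = T-== (proj₁ (Equivalence.to T-∧ agree))

  orderIso-≡ᵇ : T (at v (toℕ i) ≡ᵇ at v (toℕ j)) → T (at u (toℕ i) ≡ᵇ at u (toℕ j))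
  orderIso-≡ᵇ = T-== (proj₂ (Equivalence.to T-∧ agree))

<ᵇ-true : ∀ {m n} → m < n → (m <ᵇ n) ≡ true
<ᵇ-true m<n = Equivalence.to T-≡ (<⇒<ᵇ m<n)

<ᵇ-false : ∀ {m n} → n ≤ m → (m <ᵇ n) ≡ false
<ᵇ-false {m} {n} n≤m = ¬-not (λ eq → <⇒≱ (<ᵇ⇒< m n (Equivalence.from T-≡ eq)) n≤m)

≡ᵇ-refl : ∀ m → (m ≡ᵇ m) ≡ true
≡ᵇ-refl m = Equivalence.to T-≡ (≡⇒≡ᵇ m m refl)

≡ᵇ-false : ∀ {m n} → m ≢ n → (m ≡ᵇ n) ≡ false
≡ᵇ-false {m} {n} m≢n = ¬-not (λ eq → m≢n (≡ᵇ⇒≡ m n (Equivalence.from T-≡ eq)))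

p1232 p1322 : List ℕ
p1232 = 1 ∷ 2 ∷ 3 ∷ 2 ∷ []
p1322 = 1 ∷ 3 ∷ 2 ∷ 2 ∷ []

orderIso-1232 : ∀ {a b c} → a < b → b < c → T (orderIso (a ∷ b ∷ c ∷ b ∷ []) p1232)
orderIso-1232 {a} {b} {c} a<b b<c
  with a<c ← <-trans a<b b<c
  rewrite <ᵇ-false (≤-refl {a}) | <ᵇ-false (≤-refl {b}) | <ᵇ-false (≤-refl {c})
        | ≡ᵇ-refl a | ≡ᵇ-refl b | ≡ᵇ-refl c
        | <ᵇ-true a<b | <ᵇ-true b<c | <ᵇ-true a<c
        | <ᵇ-false (<⇒≤ a<b) | <ᵇ-false (<⇒≤ b<c) | <ᵇ-false (<⇒≤ a<c)
        | ≡ᵇ-false (<⇒≢ a<b) | ≡ᵇ-false (<⇒≢ b<c) | ≡ᵇ-false (<⇒≢ a<c)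
        | ≡ᵇ-false (≢-sym (<⇒≢ a<b)) | ≡ᵇ-false (≢-sym (<⇒≢ b<c)) | ≡ᵇ-false (≢-sym (<⇒≢ a<c))
  = tt

orderIso-1322 : ∀ {a b c} → a < c → c < b → T (orderIso (a ∷ b ∷ c ∷ c ∷ []) p1322)
orderIso-1322 {a} {b} {c} a<c c<b
  with a<b ← <-trans a<c c<b
  rewrite <ᵇ-false (≤-refl {a}) | <ᵇ-false (≤-refl {b}) | <ᵇ-false (≤-refl {c})
        | ≡ᵇ-refl a | ≡ᵇ-refl b | ≡ᵇ-refl c
        | <ᵇ-true a<c | <ᵇ-true c<b | <ᵇ-true a<b
        | <ᵇ-false (<⇒≤ a<c) | <ᵇ-false (<⇒≤ c<b) | <ᵇ-false (<⇒≤ a<b)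
        | ≡ᵇ-false (<⇒≢ a<c) | ≡ᵇ-false (<⇒≢ c<b) | ≡ᵇ-false (<⇒≢ a<b)
        | ≡ᵇ-false (≢-sym (<⇒≢ a<c)) | ≡ᵇ-false (≢-sym (<⇒≢ c<b)) | ≡ᵇ-false (≢-sym (<⇒≢ a<b))
  = tt

orderIso-1232⇔ : ∀ a b c d → T (orderIso (a ∷ b ∷ c ∷ d ∷ []) p1232) ⇔ (a < b × b < c × d ≡ b)
orderIso-1232⇔ a b c d = mk⇔ to (λ { (a<b , b<c , refl) → orderIso-1232 a<b b<c })
  where
  to : T (orderIso (a ∷ b ∷ c ∷ d ∷ []) p1232) → a < b × b < c × d ≡ b
  to h = <ᵇ⇒< a b (orderIso-<ᵇ u p1232 h (# 0) (# 1) tt) ,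
         <ᵇ⇒< b c (orderIso-<ᵇ u p1232 h (# 1) (# 2) tt) ,
         ≡ᵇ⇒≡ d b (orderIso-≡ᵇ u p1232 h (# 3) (# 1) tt)
    where
    u : List ℕ
    u = a ∷ b ∷ c ∷ d ∷ []

orderIso-1322⇔ : ∀ a b c d → T (orderIso (a ∷ b ∷ c ∷ d ∷ []) p1322) ⇔ (a < c × c < b × d ≡ c)
orderIso-1322⇔ a b c d = mk⇔ to (λ { (a<c , c<b , refl) → orderIso-1322 a<c c<b })
  where
  to : T (orderIso (a ∷ b ∷ c ∷ d ∷ []) p1322) → a < c × c < b × d ≡ c
  to h = <ᵇ⇒< a c (orderIso-<ᵇ u p1322 h (# 0) (# 2) tt) ,
         <ᵇ⇒< c b (orderIso-<ᵇ u p1322 h (# 2) (# 1) tt) ,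
         ≡ᵇ⇒≡ d c (orderIso-≡ᵇ u p1322 h (# 3) (# 2) tt)
    where
    u : List ℕ
    u = a ∷ b ∷ c ∷ d ∷ []

T-injective : ∀ {x y} → (T x → T y) → (T y → T x) → x ≡ y
T-injective {false} {false} _   _   = refl
T-injective {false} {true}  _   y⇒x = ⊥-elim (y⇒x tt)
T-injective {true}  {false} x⇒y _   = ⊥-elim (x⇒y tt)
T-injective {true}  {true}  _   _   = refl

matches-1322-flip : ∀ {k} (a b c d : Fin k) → matches p1322 a b c d ≡ matches p1232 a c b d
matches-1322-flip a b c d =
  T-injective (from p1232-acbd ∘ to p1322-abcd) (from p1322-abcd ∘ to p1232-acbd)
  where
  open Equivalence using (to; from)
  p1232-acbd : T (matches p1232 a c b d) ⇔ (toℕ a < toℕ c × toℕ c < toℕ b × toℕ d ≡ toℕ c)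
  p1232-acbd = orderIso-1232⇔ (toℕ a) (toℕ c) (toℕ b) (toℕ d)
  p1322-abcd : T (matches p1322 a b c d) ⇔ (toℕ a < toℕ c × toℕ c < toℕ b × toℕ d ≡ toℕ c)
  p1322-abcd = orderIso-1322⇔ (toℕ a) (toℕ b) (toℕ c) (toℕ d)

record Valley (a b c d : ℕ) : Set where
  field
    a<b : a < b
    a<c : a < c
    d≤b : d ≤ b
    d≤c : d ≤ c

valley : ∀ a b c d →
  T (orderIso (a ∷ b ∷ c ∷ d ∷ []) p1232 ∨ orderIso (a ∷ c ∷ b ∷ d ∷ []) p1232) → Valley a b c d
valley a b c d h with Equivalence.to T-∨ h
... | inj₁ h₁ with a<b , b<c , refl ← Equivalence.to (orderIso-1232⇔ a b c d) h₁ =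
  record { a<b = a<b ; a<c = <-trans a<b b<c ; d≤b = ≤-refl ; d≤c = <⇒≤ b<c }
... | inj₂ h₂ with a<c , c<b , refl ← Equivalence.to (orderIso-1232⇔ a c b d) h₂ =
  record { a<b = <-trans a<c c<b ; a<c = a<c ; d≤b = <⇒≤ c<b ; d≤c = ≤-refl }

module _ {k : ℕ} where

  open WindowSwap (matches {k} p1232)

  private
    valleyᶠ : ∀ a b c d → swappable a b c d ≡ true → Valley (toℕ a) (toℕ b) (toℕ c) (toℕ d)
    valleyᶠ a b c d s = valley (toℕ a) (toℕ b) (toℕ c) (toℕ d) (Equivalence.from T-≡ s)

  separated₁ : ∀ a b c d e → swappable a b c d ≡ true → swappable b c d e ≡ true → ⊥
  separated₁ a b c d e s t = <⇒≱ (Valley.a<c (valleyᶠ b c d e t)) (Valley.d≤b (valleyᶠ a b c d s))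

  separated₂ : ∀ a b c d e f → swappable a b c d ≡ true → swappable c d e f ≡ true → ⊥
  separated₂ a b c d e f s t = <⇒≱ (Valley.a<b (valleyᶠ c d e f t)) (Valley.d≤c (valleyᶠ a b c d s))

  swap1232 : ∀ {n} → Word k n → Word k n
  swap1232 = swapWindows

  swap1232-involutive : ∀ {n} (σ : Word k n) → swap1232 (swap1232 σ) ≡ σ
  swap1232-involutive = swapWindows-involutive separated₁ separated₂

  occ-1322-swap1232 : ∀ {n} (σ : Word k n) → occ p1322 (swap1232 σ) ≡ occ p1232 σ
  occ-1322-swap1232 σ = begin
    occ p1322 (swap1232 σ)                     ≡⟨ occ-countWindows 1 3 2 2 (swap1232 σ) ⟩
    countWindows (matches p1322) (swap1232 σ)  ≡⟨ countWindows-cong matches-1322-flip (swap1232 σ) ⟩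
    countWindows flipped (swap1232 σ)          ≡⟨ countWindows-swapWindows separated₁ separated₂ σ ⟩
    countWindows (matches p1232) σ             ≡⟨ occ-countWindows 1 2 3 2 σ ⟨
    occ p1232 σ                                ∎
    where open ≡-Reasoning

corollary4p2 : (k n r : ℕ) → k ≥ 1 →
    countWords (1 ∷ 2 ∷ 3 ∷ 2 ∷ []) k n r ≡ countWords (1 ∷ 3 ∷ 2 ∷ 2 ∷ []) k n r
corollary4p2 k n r _ =
  filter-≟-involution (allWords-unique k n) (∈-allWords k n) swap1232 swap1232-involutive
    (occ p1322) (occ p1232) occ-1322-swap1232 r
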